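{- Let $p$ be a prime and $0\le a\le b$ integers. Up to isomorphism, the number of regular dessins whose automorphism group is isomorphic to $\mathbb{Z}_{p^a}\oplus\mathbb{Z}_{p^b}$ equals $\psi(p^{b-a})$, where $\psi$ is the Dedekind totient function.
   Context: A regular dessin with automorphism group isomorphic to $G$ is a triple $(G,x,y)$ with $x,y$ generating $G$; $(G,x_1,y_1)\cong(G,x_2,y_2)$ if $x_1\mapsto x_2$, $y_1\mapsto y_2$ extends to an automorphism of $G$. The Dedekind totient function is $\psi(n)=n\prod_{q\mid n,\ q\text{ prime}}(1+1/q)$, with $\psi(1)=1$. -}

module Defs where

open import Data.Nat as ℕ using (ℕ; zero; suc; _+_; _∸_; _^_)
open import Data.Nat.DivMod using (_%_; m%n<n)
open import Data.Nat.Divisibility using (_∣_; _∣?_)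
open import Data.Nat.Primality using (Prime; prime?)
open import Data.Fin using (Fin; toℕ; fromℕ<)
open import Data.Product using (_×_; _,_; ∃; Σ)
open import Data.List using (List; foldr; map; upTo)
open import Data.Integer using (+_)
open import Data.Rational using (ℚ; _/_; 1ℚ; _*_)
open import Relation.Nullary using (yes; no; _×-dec_)
open import Relation.Binary.PropositionalEquality using (_≡_)
open import Function.Definitions using (Bijective)

infixl 6 _+ₘ_
_+ₘ_ : ∀ {n} → Fin n → Fin n → Fin n
_+ₘ_ {suc k} x y = fromℕ< (m%n<n (toℕ x + toℕ y) (suc k))

negₘ : ∀ {n} → Fin n → Fin n
negₘ {suc k} x = fromℕ< (m%n<n (suc k ∸ toℕ x) (suc k))

G : ℕ → ℕ → ℕ → Set
G p a b = Fin (p ^ a) × Fin (p ^ b)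

module _ {p a b : ℕ} where

  infixl 6 _⊕_
  _⊕_ : G p a b → G p a b → G p a b
  (x₁ , x₂) ⊕ (y₁ , y₂) = (x₁ +ₘ y₁) , (x₂ +ₘ y₂)

  ⊖_ : G p a b → G p a b
  ⊖ (x₁ , x₂) = negₘ x₁ , negₘ x₂

  IsSubgroup : (G p a b → Set) → Set
  IsSubgroup S = (∃ λ g → S g)
               × (∀ g h → S g → S h → S (g ⊕ h))
               × (∀ g → S g → S (⊖ g))

  Generates : G p a b → G p a b → Set₁
  Generates x y = ∀ (S : G p a b → Set) → IsSubgroup S → S x → S y → ∀ g → S g

  IsAutomorphism : (G p a b → G p a b) → Set
  IsAutomorphism f = (∀ g h → f (g ⊕ h) ≡ f g ⊕ f h) × Bijective _≡_ _≡_ f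

  -- Regular dessins with automorphism group G: generating pairs (x , y).
  Dessin : Set₁
  Dessin = Σ (G p a b × G p a b) λ { (x , y) → Generates x y }

  _≅D_ : Dessin → Dessin → Set
  ((x₁ , y₁) , _) ≅D ((x₂ , y₂) , _) =
    ∃ λ (f : G p a b → G p a b) → IsAutomorphism f × f x₁ ≡ x₂ × f y₁ ≡ y₂

-- Dedekind totient ψ(n) = n ∏_{q ∣ n, q prime} (1 + 1/q), as a rational
-- (for n ≥ 1 the prime divisors q of n are among 1,…,n; ψ(1) = 1).

ψfactor : ℕ → ℕ → ℚ
ψfactor n k with prime? (suc k) ×-dec (suc k ∣? n)
... | yes _ = + suc (suc k) / suc k     -- 1 + 1/q with q = suc k
... | no  _ = 1ℚ

ψ : ℕ → ℚ
ψ n = (+ n / 1) * foldr _*_ 1ℚ (map (ψfactor n) (upTo n))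

module Submission where

-- Put N₁ = p^a, N₂ = p^b and
-- Nc = p^c with c = b - a, so N₂ = N₁·Nc.  Each class contains exactly one
--     ((0,1) , (1,t)),  t < Nc,        or, when c ≥ 1,   ((1,kp) , (0,1)),  k < p^(c-1),
-- so there are Nc + p^(c-1) = ψ(p^c) classes (one class when c = 0).
-- A pair is moved to its representative by inverting an explicit linear
-- endomorphism of G that hits the pair (onto, hence bijective since G is
-- finite); distinct representatives are separated by element orders.

open import Defs
import Data.Nat as ℕ
open import Data.Nat hiding (_/_)
open import Data.Nat.Properties
open import Data.Nat.DivMod
  using (m%n<n; m%n≤n; m%n%n≡m%n; %-distribˡ-+; %-distribˡ-*; %-remove-+ʳ;
         [m+kn]%n≡m%n; m≡m%n+[m/n]*n; m<n⇒m%n≡m; m∣n⇒o%n%m≡o%m)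
open import Data.Nat.Divisibility
open import Data.Nat.Primality
open import Data.Nat.Coprimality using (Coprime; coprime-divisor; coprime-Bézout)
open import Data.Nat.GCD using (module Bézout)
open import Data.Nat.Tactic.RingSolver using (solve-∀)
open import Data.Fin using (Fin; toℕ; fromℕ<; punchOut)
open import Data.Fin.Properties
  using (toℕ-fromℕ<; toℕ-injective; toℕ<n; punchOut-injective; injective⇒≤; any?; *↔×)
  renaming (_≟_ to _≟ᶠ_)
open import Data.Integer using (+_)
open import Data.Rational using (_/_)
import Data.Rational as ℚ
import Data.Rational.Properties as ℚ
import Data.Rational.Unnormalised as ℚᵘ
import Data.Rational.Unnormalised.Properties as ℚᵘ
import Data.Integer as ℤ
import Data.Integer.Properties as ℤ
open import Data.List using (List; length; tabulate; _++_; foldr; map; applyUpTo)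
open import Data.List.Properties using (length-++; length-tabulate)
open import Data.List.Relation.Unary.Any using (Any)
import Data.List.Relation.Unary.Any.Properties as Any
import Data.List.Relation.Unary.All.Properties as All
open import Data.List.Relation.Unary.AllPairs using (AllPairs)
import Data.List.Relation.Unary.AllPairs.Properties as AllPairs
open import Data.Product using (Σ; ∃; _×_; _,_; proj₁; proj₂)
open import Data.Sum using (_⊎_; inj₁; inj₂; [_,_]′)
open import Data.Empty using (⊥; ⊥-elim)
open import Function using (_∘_; _↔_; Inverse)
open import Function.Definitions using (Injective)
open import Relation.Nullary using (¬_; yes; no; _×-dec_)
open import Relation.Binary.PropositionalEquality

module Congruence (n : ℕ) .{{_ : NonZero n}} where

  infix 4 _≈_
  _≈_ : ℕ → ℕ → Set
  x ≈ y = x % n ≡ y % n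

  +-cong : ∀ {x x′ y y′} → x ≈ x′ → y ≈ y′ → x + y ≈ x′ + y′
  +-cong {x} {x′} {y} {y′} e f = begin
    (x + y) % n             ≡⟨ %-distribˡ-+ x y n ⟩
    (x % n + y % n) % n     ≡⟨ cong₂ (λ u v → (u + v) % n) e f ⟩
    (x′ % n + y′ % n) % n   ≡⟨ %-distribˡ-+ x′ y′ n ⟨
    (x′ + y′) % n           ∎
    where open ≡-Reasoning

  *-cong : ∀ {x x′ y y′} → x ≈ x′ → y ≈ y′ → x * y ≈ x′ * y′
  *-cong {x} {x′} {y} {y′} e f = begin
    (x * y) % n               ≡⟨ %-distribˡ-* x y n ⟩
    (x % n * (y % n)) % n     ≡⟨ cong₂ (λ u v → (u * v) % n) e f ⟩
    (x′ % n * (y′ % n)) % n   ≡⟨ %-distribˡ-* x′ y′ n ⟨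
    (x′ * y′) % n             ∎
    where open ≡-Reasoning

  %-≈ : ∀ x → x % n ≈ x
  %-≈ x = m%n%n≡m%n x n

  +-∣-≈ : ∀ x {m} → n ∣ m → x + m ≈ x
  +-∣-≈ x n∣m = %-remove-+ʳ x n∣m

  0%n≡0 : 0 % n ≡ 0
  0%n≡0 = n∣m⇒m%n≡0 0 n (n ∣0)

  ∣⇒≈0 : ∀ {x} → n ∣ x → x ≈ 0
  ∣⇒≈0 {x} n∣x = trans (n∣m⇒m%n≡0 x n n∣x) (sym 0%n≡0)

  ≈0⇒∣ : ∀ {x} → x ≈ 0 → n ∣ x
  ≈0⇒∣ {x} x≈0 = m%n≡0⇒n∣m x n (trans x≈0 0%n≡0)

  ≈⇒≡ : ∀ {x y} → x < n → y < n → x ≈ y → x ≡ y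
  ≈⇒≡ x<n y<n e = trans (sym (m<n⇒m%n≡m x<n)) (trans e (m<n⇒m%n≡m y<n))

  complement-inverse : ∀ a → (n ∸ a % n) + a ≈ 0
  complement-inverse a = begin
    (n ∸ a % n + a) % n       ≡⟨ +-cong {n ∸ a % n} refl (sym (%-≈ a)) ⟩
    (n ∸ a % n + a % n) % n   ≡⟨ cong (_% n) (m∸n+n≡m (m%n≤n a n)) ⟩
    n % n                     ≡⟨ ∣⇒≈0 ∣-refl ⟩
    0 % n                     ∎
    where open ≡-Reasoning

  +-cancelˡ : ∀ a {x y} → a + x ≈ a + y → x ≈ y
  +-cancelˡ a {x} {y} e = begin
    x % n               ≡⟨ +-cong {w + a} {0} {x} {x} (complement-inverse a) refl ⟨
    (w + a + x) % n     ≡⟨ cong (_% n) (+-assoc w a x) ⟩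
    (w + (a + x)) % n   ≡⟨ +-cong {w} {w} refl e ⟩
    (w + (a + y)) % n   ≡⟨ cong (_% n) (+-assoc w a y) ⟨
    (w + a + y) % n     ≡⟨ +-cong {w + a} {0} {y} {y} (complement-inverse a) refl ⟩
    y % n               ∎
    where
    open ≡-Reasoning
    w = n ∸ a % n

  inverse-unique : ∀ {x y u} → x + u ≈ 0 → y + u ≈ 0 → x ≈ y
  inverse-unique {x} {y} {u} e f = +-cancelˡ u (begin
    (u + x) % n   ≡⟨ cong (_% n) (+-comm u x) ⟩
    (x + u) % n   ≡⟨ trans e (sym f) ⟩
    (y + u) % n   ≡⟨ cong (_% n) (+-comm y u) ⟩
    (u + y) % n   ∎)
    where open ≡-Reasoning

  negation-as-multiple : ∀ N .{{_ : NonZero N}} → n ∣ N → ∀ u →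
                         (n ∸ u % n) % n ≡ ((N ∸ 1) * u) % n
  negation-as-multiple N n∣N u =
    inverse-unique {u = u} (complement-inverse u) (∣⇒≈0 (subst (n ∣_) N*u≡ (∣m⇒∣m*n u n∣N)))
    where
    N*u≡ : N * u ≡ (N ∸ 1) * u + u
    N*u≡ = begin
      N * u                 ≡⟨ cong (_* u) (m∸n+n≡m (>-nonZero⁻¹ N)) ⟨
      (N ∸ 1 + 1) * u       ≡⟨ *-distribʳ-+ u (N ∸ 1) 1 ⟩
      (N ∸ 1) * u + 1 * u   ≡⟨ cong (λ w → (N ∸ 1) * u + w) (*-identityˡ u) ⟩
      (N ∸ 1) * u + u       ∎
      where open ≡-Reasoning

  inverse : ∀ X → Coprime X n → ∃ λ u → u * X ≈ 1
  inverse X cop with coprime-Bézout cop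
  ... | Bézout.+- u v eq = u , trans (cong (_% n) (sym eq)) ([m+kn]%n≡m%n 1 v n)
  ... | Bézout.-+ u v eq = (n ∸ 1) * u , (begin
      ((n ∸ 1) * u * X) % n               ≡⟨ [m+kn]%n≡m%n _ v n ⟨
      ((n ∸ 1) * u * X + v * n) % n       ≡⟨ cong (_% n) shift ⟩
      (1 + (u * X) * n) % n               ≡⟨ [m+kn]%n≡m%n 1 (u * X) n ⟩
      1 % n                               ∎)
    where
    open ≡-Reasoning
    expand : ∀ m u x → m * u * x + (1 + u * x) ≡ 1 + (u * x) * (m + 1)
    expand = solve-∀
    shift : (n ∸ 1) * u * X + v * n ≡ 1 + (u * X) * n
    shift = trans (cong (λ w → (n ∸ 1) * u * X + w) (sym eq))
              (trans (expand (n ∸ 1) u X) (cong (λ w → 1 + (u * X) * w) (m∸n+n≡m (>-nonZero⁻¹ n))))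

  solve-linear : ∀ X Y → Coprime X n → ∃ λ t → t < n × t * X ≈ Y
  solve-linear X Y cop = t , m%n<n _ n , (begin
      (t * X) % n       ≡⟨ *-cong (%-≈ (u * Y)) refl ⟩
      (u * Y * X) % n   ≡⟨ cong (_% n) (swap u Y X) ⟩
      (u * X * Y) % n   ≡⟨ *-cong (proj₂ (inverse X cop)) refl ⟩
      (1 * Y) % n       ≡⟨ cong (_% n) (*-identityˡ Y) ⟩
      Y % n             ∎)
    where
    open ≡-Reasoning
    u = proj₁ (inverse X cop)
    t = (u * Y) % n
    swap : ∀ a b c → a * b * c ≡ a * c * b
    swap = solve-∀

coprime-divisor-of-power : ∀ {p} → Prime p → ∀ k d → ¬ p ∣ d → d ∣ p ^ k → d ≡ 1
coprime-divisor-of-power pr zero d p∤d d∣1 = ∣1⇒≡1 d∣1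
coprime-divisor-of-power {p} pr (suc k) d p∤d d∣pp^k =
  coprime-divisor-of-power pr k d p∤d (coprime-divisor d⊥p d∣pp^k)
  where
  d⊥p : Coprime d p
  d⊥p {e} (e∣d , e∣p) with prime⇒irreducible pr e∣p
  ... | inj₁ e≡1 = e≡1
  ... | inj₂ refl = ⊥-elim (p∤d e∣d)

prime-divisor-of-power : ∀ {p r} → Prime p → Prime r → ∀ k → r ∣ p ^ k → r ≡ p
prime-divisor-of-power pp pr zero r∣1 = ⊥-elim (nonTrivial⇒≢1 {{prime⇒nonTrivial pr}} (∣1⇒≡1 r∣1))
prime-divisor-of-power {p} pp pr (suc k) r∣pp^k with euclidsLemma p (p ^ k) pr r∣pp^k
... | inj₂ r∣p^k = prime-divisor-of-power pp pr k r∣p^k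
... | inj₁ r∣p with prime⇒irreducible pp r∣p
...   | inj₁ r≡1 = ⊥-elim (nonTrivial⇒≢1 {{prime⇒nonTrivial pr}} r≡1)
...   | inj₂ r≡p = r≡p

injective-endo-hits : ∀ {n} (h : Fin n → Fin n) → Injective _≡_ _≡_ h →
                      ∀ z → ¬ (∀ i → h i ≢ z)
injective-endo-hits {suc n} h h-inj z misses = 1+n≰n (injective⇒≤ {f = h′} h′-inj)
  where
  h′ : Fin (suc n) → Fin n
  h′ i = punchOut (misses i ∘ sym)
  h′-inj : Injective _≡_ _≡_ h′
  h′-inj {i} {j} e = h-inj (punchOut-injective (misses i ∘ sym) (misses j ∘ sym) e)

module FiniteSet {A : Set} {n : ℕ} (enumeration : Fin n ↔ A) where
  open Inverse enumeration using (to; from; strictlyInverseˡ; strictlyInverseʳ)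

  injective⇒surjective : (s : A → A) → Injective _≡_ _≡_ s → ∀ z → ∃ λ x → s x ≡ z
  injective⇒surjective s s-inj z with any? (λ i → from (s (to i)) ≟ᶠ from z)
  ... | yes (i , e) = to i , trans (sym (strictlyInverseˡ _)) (trans (cong to e) (strictlyInverseˡ z))
  ... | no none = ⊥-elim (injective-endo-hits (from ∘ s ∘ to) h-inj (from z) (λ i e → none (i , e)))
    where
    h-inj : Injective _≡_ _≡_ (from ∘ s ∘ to)
    h-inj {i} {j} e = trans (sym (strictlyInverseʳ i)) (trans (cong from to-eq) (strictlyInverseʳ j))
      where
      to-eq : to i ≡ to j
      to-eq = s-inj (trans (sym (strictlyInverseˡ _)) (trans (cong to e) (strictlyInverseˡ _)))

  rightInverse⇒injective : (f s : A → A) → (∀ y → f (s y) ≡ y) → Injective _≡_ _≡_ f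
  rightInverse⇒injective f s fs {x} {y} e = trans (sym (s∘f x)) (trans (cong s e) (s∘f y))
    where
    s-inj : Injective _≡_ _≡_ s
    s-inj {u} {v} q = trans (sym (fs u)) (trans (cong f q) (fs v))
    s∘f : ∀ x → s (f x) ≡ x
    s∘f x = let (m , sm≡x) = injective⇒surjective s s-inj x in
      trans (cong (s ∘ f) (sym sm≡x)) (trans (cong s (fs m)) sm≡x)

toℕ-+ₘ : ∀ {n} .{{_ : NonZero n}} (x y : Fin n) → toℕ (x +ₘ y) ≡ (toℕ x + toℕ y) % n
toℕ-+ₘ {suc _} x y = toℕ-fromℕ< _

toℕ-negₘ : ∀ {n} .{{_ : NonZero n}} (x : Fin n) → toℕ (negₘ x) ≡ (n ∸ toℕ x) % n
toℕ-negₘ {suc _} x = toℕ-fromℕ< _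

-- Coordinates for G = Z_{p^a} ⊕ Z_{p^b} (any p, a, b with p^a ∣ p^b):
-- every element is elt u v for natural u, v, and the group operations
-- act on coordinates as addition and multiplication by N₂ - 1.
module Coordinates (p a b : ℕ) {{_ : NonZero (p ^ a)}} {{_ : NonZero (p ^ b)}}
                   (N₁∣N₂ : p ^ a ∣ p ^ b) where

  N₁ N₂ : ℕ
  N₁ = p ^ a
  N₂ = p ^ b
  module M₁ = Congruence N₁
  module M₂ = Congruence N₂

  GG : Set
  GG = G p a b

  infixl 6 _⊞_
  _⊞_ : GG → GG → GG
  _⊞_ = _⊕_ {p} {a} {b}

  ⊟ : GG → GG
  ⊟ = ⊖_ {p} {a} {b}

  elt : ℕ → ℕ → GG
  elt u v = fromℕ< (m%n<n u N₁) , fromℕ< (m%n<n v N₂)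

  π₁ π₂ : GG → ℕ
  π₁ g = toℕ (proj₁ g)
  π₂ g = toℕ (proj₂ g)

  π₁-elt : ∀ u v → π₁ (elt u v) ≡ u % N₁
  π₁-elt u v = toℕ-fromℕ< _

  π₂-elt : ∀ u v → π₂ (elt u v) ≡ v % N₂
  π₂-elt u v = toℕ-fromℕ< _

  elt-≡ : ∀ {u v u′ v′} → u M₁.≈ u′ → v M₂.≈ v′ → elt u v ≡ elt u′ v′
  elt-≡ {u} {v} {u′} {v′} e f = cong₂ _,_
    (toℕ-injective (trans (π₁-elt u v) (trans e (sym (π₁-elt u′ v′)))))
    (toℕ-injective (trans (π₂-elt u v) (trans f (sym (π₂-elt u′ v′)))))

  elt-≡⁻¹ : ∀ {u v u′ v′} → elt u v ≡ elt u′ v′ → u M₁.≈ u′ × v M₂.≈ v′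
  elt-≡⁻¹ {u} {v} {u′} {v′} e =
    trans (sym (π₁-elt u v)) (trans (cong π₁ e) (π₁-elt u′ v′)) ,
    trans (sym (π₂-elt u v)) (trans (cong π₂ e) (π₂-elt u′ v′))

  η : ∀ g → g ≡ elt (π₁ g) (π₂ g)
  η (g₁ , g₂) = cong₂ _,_
    (toℕ-injective (trans (sym (m<n⇒m%n≡m (toℕ<n g₁))) (sym (toℕ-fromℕ< _))))
    (toℕ-injective (trans (sym (m<n⇒m%n≡m (toℕ<n g₂))) (sym (toℕ-fromℕ< _))))

  ≈₂⇒≈₁ : ∀ {x y} → x M₂.≈ y → x M₁.≈ y
  ≈₂⇒≈₁ {x} {y} e = trans (sym (m∣n⇒o%n%m≡o%m N₁ N₂ x N₁∣N₂))
                      (trans (cong (_% N₁) e) (m∣n⇒o%n%m≡o%m N₁ N₂ y N₁∣N₂))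

  ⊞-elt : ∀ u v u′ v′ → elt u v ⊞ elt u′ v′ ≡ elt (u + u′) (v + v′)
  ⊞-elt u v u′ v′ = cong₂ _,_
    (toℕ-injective (begin
      toℕ (proj₁ (elt u v) +ₘ proj₁ (elt u′ v′))  ≡⟨ toℕ-+ₘ _ _ ⟩
      (π₁ (elt u v) + π₁ (elt u′ v′)) % N₁        ≡⟨ cong₂ (λ s t → (s + t) % N₁) (π₁-elt u v) (π₁-elt u′ v′) ⟩
      (u % N₁ + u′ % N₁) % N₁                     ≡⟨ %-distribˡ-+ u u′ N₁ ⟨
      (u + u′) % N₁                               ≡⟨ π₁-elt (u + u′) (v + v′) ⟨
      π₁ (elt (u + u′) (v + v′))                  ∎))
    (toℕ-injective (begin
      toℕ (proj₂ (elt u v) +ₘ proj₂ (elt u′ v′))  ≡⟨ toℕ-+ₘ _ _ ⟩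
      (π₂ (elt u v) + π₂ (elt u′ v′)) % N₂        ≡⟨ cong₂ (λ s t → (s + t) % N₂) (π₂-elt u v) (π₂-elt u′ v′) ⟩
      (v % N₂ + v′ % N₂) % N₂                     ≡⟨ %-distribˡ-+ v v′ N₂ ⟨
      (v + v′) % N₂                               ≡⟨ π₂-elt (u + u′) (v + v′) ⟨
      π₂ (elt (u + u′) (v + v′))                  ∎))
    where open ≡-Reasoning

  ⊟-elt : ∀ u v → ⊟ (elt u v) ≡ elt ((N₂ ∸ 1) * u) ((N₂ ∸ 1) * v)
  ⊟-elt u v = cong₂ _,_
    (toℕ-injective (begin
      toℕ (negₘ (proj₁ (elt u v)))        ≡⟨ toℕ-negₘ _ ⟩
      (N₁ ∸ π₁ (elt u v)) % N₁            ≡⟨ cong (λ s → (N₁ ∸ s) % N₁) (π₁-elt u v) ⟩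
      (N₁ ∸ u % N₁) % N₁                  ≡⟨ M₁.negation-as-multiple N₂ N₁∣N₂ u ⟩
      ((N₂ ∸ 1) * u) % N₁                 ≡⟨ π₁-elt _ ((N₂ ∸ 1) * v) ⟨
      π₁ (elt ((N₂ ∸ 1) * u) ((N₂ ∸ 1) * v)) ∎))
    (toℕ-injective (begin
      toℕ (negₘ (proj₂ (elt u v)))        ≡⟨ toℕ-negₘ _ ⟩
      (N₂ ∸ π₂ (elt u v)) % N₂            ≡⟨ cong (λ s → (N₂ ∸ s) % N₂) (π₂-elt u v) ⟩
      (N₂ ∸ v % N₂) % N₂                  ≡⟨ M₂.negation-as-multiple N₂ ∣-refl v ⟩
      ((N₂ ∸ 1) * v) % N₂                 ≡⟨ π₂-elt ((N₂ ∸ 1) * u) _ ⟨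
      π₂ (elt ((N₂ ∸ 1) * u) ((N₂ ∸ 1) * v)) ∎))
    where open ≡-Reasoning

  O : GG
  O = elt 0 0

  mul : ℕ → GG → GG
  mul zero g = O
  mul (suc k) g = g ⊞ mul k g

  mul-elt : ∀ k u v → mul k (elt u v) ≡ elt (k * u) (k * v)
  mul-elt zero u v = refl
  mul-elt (suc k) u v = trans (cong (elt u v ⊞_) (mul-elt k u v)) (⊞-elt u v (k * u) (k * v))

  ⊟-inverse : ∀ g → g ⊞ ⊟ g ≡ O
  ⊟-inverse g = begin
    g ⊞ ⊟ g                               ≡⟨ cong (λ w → w ⊞ ⊟ w) (η g) ⟩
    elt g₁ g₂ ⊞ ⊟ (elt g₁ g₂)             ≡⟨ cong (elt g₁ g₂ ⊞_) (⊟-elt g₁ g₂) ⟩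
    elt g₁ g₂ ⊞ elt (M * g₁) (M * g₂)     ≡⟨ ⊞-elt _ _ _ _ ⟩
    elt (g₁ + M * g₁) (g₂ + M * g₂)       ≡⟨ cong₂ elt (times-N₂ g₁) (times-N₂ g₂) ⟩
    elt (N₂ * g₁) (N₂ * g₂)               ≡⟨ elt-≡ (M₁.∣⇒≈0 (∣m⇒∣m*n g₁ N₁∣N₂)) (M₂.∣⇒≈0 (m∣m*n g₂)) ⟩
    O                                     ∎
    where
    open ≡-Reasoning
    M = N₂ ∸ 1
    g₁ = π₁ g
    g₂ = π₂ g
    times-N₂ : ∀ x → x + M * x ≡ N₂ * x
    times-N₂ x = trans (cong (_+ M * x) (sym (*-identityˡ x)))
                   (trans (sym (*-distribʳ-+ x 1 M)) (cong (_* x) (m+[n∸m]≡n (>-nonZero⁻¹ N₂))))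

  module Subgroup {S : GG → Set} (sub : IsSubgroup {p} {a} {b} S) where
    contains-O : S O
    contains-O = let ((g , Sg) , closed-⊞ , closed-⊟) = sub in
      subst S (⊟-inverse g) (closed-⊞ _ _ Sg (closed-⊟ _ Sg))

    contains-mul : ∀ k {g} → S g → S (mul k g)
    contains-mul zero Sg = contains-O
    contains-mul (suc k) Sg = proj₁ (proj₂ sub) _ _ Sg (contains-mul k Sg)

  generates-swap : ∀ {x y} → Generates {p} {a} {b} x y → Generates {p} {a} {b} y x
  generates-swap gen S sub Sy Sx = gen S sub Sx Sy

  module Automorphism (f : GG → GG) (aut : IsAutomorphism {p} {a} {b} f) where
    hom : ∀ g h → f (g ⊞ h) ≡ f g ⊞ f h
    hom = proj₁ aut

    injective : ∀ {x y} → f x ≡ f y → x ≡ y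
    injective = proj₁ (proj₂ aut)

    preserves-O : f O ≡ O
    preserves-O = trans (η z) (elt-≡ (sym z₁≈0) (sym z₂≈0))
      where
      z = f O
      z≡z⊞z : elt (π₁ z) (π₂ z) ≡ elt (π₁ z + π₁ z) (π₂ z + π₂ z)
      z≡z⊞z = trans (sym (η z)) (trans (cong f (sym (⊞-elt 0 0 0 0)))
                (trans (hom O O) (trans (cong₂ _⊞_ (η z) (η z)) (⊞-elt _ _ _ _))))
      z₁≈0 : 0 M₁.≈ π₁ z
      z₁≈0 = M₁.+-cancelˡ (π₁ z) (trans (cong (_% N₁) (+-identityʳ (π₁ z))) (proj₁ (elt-≡⁻¹ z≡z⊞z)))
      z₂≈0 : 0 M₂.≈ π₂ z
      z₂≈0 = M₂.+-cancelˡ (π₂ z) (trans (cong (_% N₂) (+-identityʳ (π₂ z))) (proj₂ (elt-≡⁻¹ z≡z⊞z)))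

    preserves-mul : ∀ k g → f (mul k g) ≡ mul k (f g)
    preserves-mul zero g = preserves-O
    preserves-mul (suc k) g = trans (hom g (mul k g)) (cong (f g ⊞_) (preserves-mul k g))

  -- An endomorphism of G whose image contains a generating pair (Q , P)
  -- is onto, hence bijective (G is finite); its inverse is an automorphism
  -- moving (Q , P) back to any chosen preimages (q , r).
  module InverseAutomorphism (f : GG → GG)
    (hom : ∀ g h → f (g ⊞ h) ≡ f g ⊞ f h) (neg : ∀ g → f (⊟ g) ≡ ⊟ (f g))
    (Q P q r : GG) (fq : f q ≡ Q) (fr : f r ≡ P) (gen : Generates {p} {a} {b} Q P) where

    image-subgroup : IsSubgroup {p} {a} {b} (λ g → Σ GG λ h → f h ≡ g)
    image-subgroup = (Q , q , fq)
      , (λ _ _ (g , e) (h , e′) → g ⊞ h , trans (hom g h) (cong₂ _⊞_ e e′))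
      , (λ _ (g , e) → ⊟ g , trans (neg g) (cong ⊟ e))

    sec : GG → GG
    sec g = proj₁ (gen _ image-subgroup (q , fq) (r , fr) g)

    f∘sec : ∀ g → f (sec g) ≡ g
    f∘sec g = proj₂ (gen _ image-subgroup (q , fq) (r , fr) g)

    f-injective : ∀ {x y} → f x ≡ f y → x ≡ y
    f-injective = FiniteSet.rightInverse⇒injective *↔× f sec f∘sec

    sec-automorphism : IsAutomorphism {p} {a} {b} sec
    sec-automorphism =
        (λ g h → f-injective (trans (f∘sec (g ⊞ h))
                   (sym (trans (hom (sec g) (sec h)) (cong₂ _⊞_ (f∘sec g) (f∘sec h))))))
      , (λ {x} {y} e → trans (sym (f∘sec x)) (trans (cong f e) (f∘sec y)))
      , (λ y → f y , λ { refl → f-injective (f∘sec (f y)) })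

    sec-Q : sec Q ≡ q
    sec-Q = f-injective (trans (f∘sec Q) (sym fq))

    sec-P : sec P ≡ r
    sec-P = f-injective (trans (f∘sec P) (sym fr))

  %N₁-harmless : ∀ {A₂} → N₂ ∣ N₁ * A₂ → ∀ u → ((u % N₁) * A₂) M₂.≈ (u * A₂)
  %N₁-harmless {A₂} N₂∣N₁A₂ u = sym (begin
    (u * A₂) % N₂                                   ≡⟨ cong (λ z → (z * A₂) % N₂) (m≡m%n+[m/n]*n u N₁) ⟩
    ((u % N₁ + (u ℕ./ N₁) * N₁) * A₂) % N₂          ≡⟨ cong (_% N₂) (regroup (u % N₁) (u ℕ./ N₁) N₁ A₂) ⟩
    ((u % N₁) * A₂ + (u ℕ./ N₁) * (N₁ * A₂)) % N₂   ≡⟨ M₂.+-∣-≈ _ (∣n⇒∣m*n (u ℕ./ N₁) N₂∣N₁A₂) ⟩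
    ((u % N₁) * A₂) % N₂                            ∎)
    where
    open ≡-Reasoning
    regroup : ∀ x y z w → (x + y * z) * w ≡ x * w + y * (z * w)
    regroup = solve-∀

  module Linear (A₁ A₂ B₁ B₂ : ℕ) (well-defined : N₂ ∣ N₁ * A₂) where
    f : GG → GG
    f g = elt (π₁ g * A₁ + π₂ g * B₁) (π₁ g * A₂ + π₂ g * B₂)

    f-elt : ∀ u v → f (elt u v) ≡ elt (u * A₁ + v * B₁) (u * A₂ + v * B₂)
    f-elt u v rewrite π₁-elt u v | π₂-elt u v = elt-≡
      (M₁.+-cong (M₁.*-cong (M₁.%-≈ u) refl) (M₁.*-cong (≈₂⇒≈₁ (M₂.%-≈ v)) refl))
      (M₂.+-cong (%N₁-harmless well-defined u) (M₂.*-cong (M₂.%-≈ v) refl))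

    hom : ∀ g h → f (g ⊞ h) ≡ f g ⊞ f h
    hom g h = begin
      f (g ⊞ h)                           ≡⟨ cong f (cong₂ _⊞_ (η g) (η h)) ⟩
      f (elt g₁ g₂ ⊞ elt h₁ h₂)           ≡⟨ cong f (⊞-elt g₁ g₂ h₁ h₂) ⟩
      f (elt (g₁ + h₁) (g₂ + h₂))         ≡⟨ f-elt _ _ ⟩
      elt ((g₁ + h₁) * A₁ + (g₂ + h₂) * B₁) ((g₁ + h₁) * A₂ + (g₂ + h₂) * B₂)
        ≡⟨ cong₂ elt (distribute g₁ h₁ A₁ g₂ h₂ B₁) (distribute g₁ h₁ A₂ g₂ h₂ B₂) ⟩
      elt ((g₁ * A₁ + g₂ * B₁) + (h₁ * A₁ + h₂ * B₁)) ((g₁ * A₂ + g₂ * B₂) + (h₁ * A₂ + h₂ * B₂))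
        ≡⟨ ⊞-elt _ _ _ _ ⟨
      f g ⊞ f h                           ∎
      where
      open ≡-Reasoning
      g₁ = π₁ g
      g₂ = π₂ g
      h₁ = π₁ h
      h₂ = π₂ h
      distribute : ∀ a b c d e k → (a + b) * c + (d + e) * k ≡ (a * c + d * k) + (b * c + e * k)
      distribute = solve-∀

    neg : ∀ g → f (⊟ g) ≡ ⊟ (f g)
    neg g = begin
      f (⊟ g)                             ≡⟨ cong (f ∘ ⊟) (η g) ⟩
      f (⊟ (elt g₁ g₂))                   ≡⟨ cong f (⊟-elt g₁ g₂) ⟩
      f (elt (M * g₁) (M * g₂))           ≡⟨ f-elt _ _ ⟩
      elt (M * g₁ * A₁ + M * g₂ * B₁) (M * g₁ * A₂ + M * g₂ * B₂)
        ≡⟨ cong₂ elt (factor M g₁ A₁ g₂ B₁) (factor M g₁ A₂ g₂ B₂) ⟩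
      elt (M * (g₁ * A₁ + g₂ * B₁)) (M * (g₁ * A₂ + g₂ * B₂)) ≡⟨ ⊟-elt _ _ ⟨
      ⊟ (f g)                             ∎
      where
      open ≡-Reasoning
      M = N₂ ∸ 1
      g₁ = π₁ g
      g₂ = π₂ g
      factor : ∀ m x a y b → m * x * a + m * y * b ≡ m * (x * a + y * b)
      factor = solve-∀

module Classification (p a b c : ℕ) (prime : Prime p) (b≡a+c : b ≡ a + c) where

  instance
    p≢0 : NonZero p
    p≢0 = prime⇒nonZero prime
    p^a≢0 : NonZero (p ^ a)
    p^a≢0 = m^n≢0 p a
    p^b≢0 : NonZero (p ^ b)
    p^b≢0 = m^n≢0 p b
    p^c≢0 : NonZero (p ^ c)
    p^c≢0 = m^n≢0 p c

  p^b≡p^a*p^c : p ^ b ≡ p ^ a * p ^ c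
  p^b≡p^a*p^c = trans (cong (p ^_) b≡a+c) (^-distribˡ-+-* p a c)

  N₁∣N₂ : p ^ a ∣ p ^ b
  N₁∣N₂ = subst (p ^ a ∣_) (sym p^b≡p^a*p^c) (m∣m*n (p ^ c))

  open Coordinates p a b N₁∣N₂ public

  Nc : ℕ
  Nc = p ^ c

  module Mc = Congruence Nc
  open Mc using () renaming (_≈_ to _≈c_)

  Nc∣N₂ : Nc ∣ N₂
  Nc∣N₂ = subst (Nc ∣_) (sym p^b≡p^a*p^c) (n∣m*n N₁)

  <Nc⇒≤N₂ : ∀ {t} → t < Nc → t ≤ N₂
  <Nc⇒≤N₂ t<Nc = ≤-trans (<⇒≤ t<Nc) (∣⇒≤ Nc∣N₂)

  1<p : 1 < p
  1<p = nonTrivial⇒n>1 p {{prime⇒nonTrivial prime}}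

  Des : Set₁
  Des = Dessin {p} {a} {b}

  infix 4 _≅_
  _≅_ : Des → Des → Set
  _≅_ = _≅D_ {p} {a} {b}

  -- (0,1) and (1,t) generate G: (g₁ , g₂) = g₁·(1,t) + (g₂ + (N₂ - t) g₁)·(0,1).
  standard-generates : ∀ t → t ≤ N₂ → Generates {p} {a} {b} (elt 0 1) (elt 1 t)
  standard-generates t t≤N₂ S sub S01 S1t g =
    subst S (sym decompose) (proj₁ (proj₂ sub) _ _ (contains-mul g₁ S1t) (contains-mul w S01))
    where
    open Subgroup sub
    open ≡-Reasoning
    g₁ = π₁ g
    g₂ = π₂ g
    w = g₂ + (N₂ ∸ t) * g₁
    first : ∀ x y → x ≡ x * 1 + y * 0
    first = solve-∀
    second : g₁ * t + w * 1 ≡ g₂ + N₂ * g₁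
    second = trans (regroup g₁ t g₂ (N₂ ∸ t)) (cong (λ z → g₂ + z * g₁) (m+[n∸m]≡n t≤N₂))
      where
      regroup : ∀ x t y k → x * t + (y + k * x) * 1 ≡ y + (t + k) * x
      regroup = solve-∀
    decompose : g ≡ mul g₁ (elt 1 t) ⊞ mul w (elt 0 1)
    decompose = begin
      g                                           ≡⟨ η g ⟩
      elt g₁ g₂                                   ≡⟨ elt-≡ (cong (_% N₁) (first g₁ w))
                                                           (sym (trans (cong (_% N₂) second) (M₂.+-∣-≈ g₂ (m∣m*n g₁)))) ⟩
      elt (g₁ * 1 + w * 0) (g₁ * t + w * 1)       ≡⟨ ⊞-elt _ _ _ _ ⟨
      elt (g₁ * 1) (g₁ * t) ⊞ elt (w * 0) (w * 1) ≡⟨ cong₂ _⊞_ (mul-elt g₁ 1 t) (mul-elt w 0 1) ⟨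
      mul g₁ (elt 1 t) ⊞ mul w (elt 0 1)          ∎

  killed-by-N₁ : ∀ s → mul N₁ (elt 1 s) ≡ O → Nc ∣ s
  killed-by-N₁ s e = *-cancelˡ-∣ N₁ (subst (_∣ N₁ * s) p^b≡p^a*p^c
    (M₂.≈0⇒∣ (proj₂ (elt-≡⁻¹ (trans (sym (mul-elt N₁ 1 s)) e)))))

  killed-by-N₁⁻¹ : ∀ s → Nc ∣ s → mul N₁ (elt 1 s) ≡ O
  killed-by-N₁⁻¹ s Nc∣s = trans (mul-elt N₁ 1 s) (elt-≡ (M₁.∣⇒≈0 (m∣m*n 1))
    (M₂.∣⇒≈0 (subst (_∣ N₁ * s) (sym p^b≡p^a*p^c) (*-monoʳ-∣ N₁ Nc∣s))))

  -- For K = N₂ - t the element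
  -- (1,t) + K(0,1) = (1, t + K) is killed by N₁, hence so is its image
  -- (1, t′ + K); thus t′ + K ≡ 0 ≡ t + K (mod Nc).
  standard-rigid : ∀ {t t′} → t < Nc → t′ < Nc → (f : GG → GG) → IsAutomorphism {p} {a} {b} f →
                   f (elt 0 1) ≡ elt 0 1 → f (elt 1 t) ≡ elt 1 t′ → t ≡ t′
  standard-rigid {t} {t′} t<Nc t′<Nc f aut f01 f1t =
    Mc.≈⇒≡ t<Nc t′<Nc (sym (Mc.+-cancelˡ K K+t′≈K+t))
    where
    open Automorphism f aut
    open ≡-Reasoning
    K = N₂ ∸ t
    shift : ℕ → GG
    shift s = elt 1 s ⊞ mul K (elt 0 1)
    shift-elt : ∀ s → shift s ≡ elt 1 (s + K)
    shift-elt s = trans (cong (elt 1 s ⊞_) (mul-elt K 0 1))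
      (trans (⊞-elt 1 s (K * 0) (K * 1))
             (cong₂ elt (cong (λ z → 1 + z) (*-zeroʳ K)) (cong (λ z → s + z) (*-identityʳ K))))
    f-shift : f (shift t) ≡ shift t′
    f-shift = trans (hom _ _) (cong₂ _⊞_ f1t (trans (preserves-mul K _) (cong (mul K) f01)))
    kills-t : mul N₁ (shift t) ≡ O
    kills-t = trans (cong (mul N₁) (shift-elt t))
      (killed-by-N₁⁻¹ (t + K) (subst (Nc ∣_) (sym (m+[n∸m]≡n (<Nc⇒≤N₂ t<Nc))) Nc∣N₂))
    kills-t′ : mul N₁ (shift t′) ≡ O
    kills-t′ = begin
      mul N₁ (shift t′)       ≡⟨ cong (mul N₁) f-shift ⟨
      mul N₁ (f (shift t))    ≡⟨ preserves-mul N₁ _ ⟨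
      f (mul N₁ (shift t))    ≡⟨ cong f kills-t ⟩
      f O                     ≡⟨ preserves-O ⟩
      O                       ∎
    Nc∣s+K : ∀ s → mul N₁ (shift s) ≡ O → Nc ∣ s + K
    Nc∣s+K s e = killed-by-N₁ (s + K) (trans (cong (mul N₁) (sym (shift-elt s))) e)
    K+t′≈K+t : K + t′ ≈c K + t
    K+t′≈K+t = begin
      (K + t′) % Nc   ≡⟨ cong (_% Nc) (+-comm K t′) ⟩
      (t′ + K) % Nc   ≡⟨ Mc.∣⇒≈0 (Nc∣s+K t′ kills-t′) ⟩
      0 % Nc          ≡⟨ Mc.∣⇒≈0 (Nc∣s+K t kills-t) ⟨
      (t + K) % Nc    ≡⟨ cong (_% Nc) (+-comm t K) ⟩
      (K + t) % Nc    ∎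

  -- For a pair (Q , P) with t·Q₂ ≡ P₂ (mod Nc), the linear map
  -- (u , v) ↦ u(P - tQ) + vQ sends (0,1) ↦ Q and (1,t) ↦ P; it is well
  -- defined since P₂ - tQ₂ ≡ 0 (mod Nc).
  module LinearToPair (Q P : GG) {t : ℕ} (t<Nc : t < Nc) (tQ≈P : t * π₂ Q ≈c π₂ P) where
    open ≡-Reasoning
    K = N₂ ∸ t
    Q₁ = π₁ Q
    Q₂ = π₂ Q
    P₁ = π₁ P
    P₂ = π₂ P
    -- the image of (1,0) is P - tQ = P + K Q
    A₁ = P₁ + K * Q₁
    A₂ = P₂ + K * Q₂

    image-of-1t : ∀ x y → 1 * (x + K * y) + t * y ≡ x + N₂ * y
    image-of-1t x y = trans (regroup x K y t) (cong (λ w → x + w * y) (m∸n+n≡m (<Nc⇒≤N₂ t<Nc)))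
      where
      regroup : ∀ x k y t → 1 * (x + k * y) + t * y ≡ x + (k + t) * y
      regroup = solve-∀

    A₂≈0 : A₂ ≈c 0
    A₂≈0 = Mc.+-cancelˡ (t * Q₂) (begin
      (t * Q₂ + A₂) % Nc    ≡⟨ cong (_% Nc) (trans (+-comm (t * Q₂) A₂)
                                (trans (cong (_+ t * Q₂) (sym (*-identityˡ A₂))) (image-of-1t P₂ Q₂))) ⟩
      (P₂ + N₂ * Q₂) % Nc   ≡⟨ Mc.+-∣-≈ P₂ (∣m⇒∣m*n Q₂ Nc∣N₂) ⟩
      P₂ % Nc               ≡⟨ tQ≈P ⟨
      (t * Q₂) % Nc         ≡⟨ cong (_% Nc) (+-identityʳ _) ⟨
      (t * Q₂ + 0) % Nc     ∎)

    open Linear A₁ A₂ Q₁ Q₂ (subst (_∣ N₁ * A₂) (sym p^b≡p^a*p^c) (*-monoʳ-∣ N₁ (Mc.≈0⇒∣ A₂≈0))) public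

    f01 : f (elt 0 1) ≡ Q
    f01 = trans (f-elt 0 1) (trans (cong₂ elt (image-of-01 A₁ Q₁) (image-of-01 A₂ Q₂)) (sym (η Q)))
      where
      image-of-01 : ∀ x y → 0 * x + 1 * y ≡ y
      image-of-01 = solve-∀

    f1t : f (elt 1 t) ≡ P
    f1t = begin
      f (elt 1 t)                             ≡⟨ f-elt 1 t ⟩
      elt (1 * A₁ + t * Q₁) (1 * A₂ + t * Q₂) ≡⟨ cong₂ elt (image-of-1t P₁ Q₁) (image-of-1t P₂ Q₂) ⟩
      elt (P₁ + N₂ * Q₁) (P₂ + N₂ * Q₂)       ≡⟨ elt-≡ (M₁.+-∣-≈ P₁ (∣m⇒∣m*n Q₁ N₁∣N₂))
                                                       (M₂.+-∣-≈ P₂ (m∣m*n Q₂)) ⟩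
      elt P₁ P₂                               ≡⟨ η P ⟨
      P                                       ∎

  to-standard : (Q P : GG) {t : ℕ} → t < Nc → t * π₂ Q ≈c π₂ P → Generates {p} {a} {b} Q P →
                Σ (GG → GG) λ h → IsAutomorphism {p} {a} {b} h × h Q ≡ elt 0 1 × h P ≡ elt 1 t
  to-standard Q P {t} t<Nc tQ≈P gen = sec , sec-automorphism , sec-Q , sec-P
    where
    open LinearToPair Q P t<Nc tQ≈P
    open InverseAutomorphism f hom neg Q P (elt 0 1) (elt 1 t) f01 f1t gen

  solve-mod-Nc : ∀ X Y → Nc ≡ 1 ⊎ ¬ p ∣ X → ∃ λ t → t < Nc × t * X ≈c Y
  solve-mod-Nc X Y unit = Mc.solve-linear X Y (coprime unit)
    where
    coprime : Nc ≡ 1 ⊎ ¬ p ∣ X → Coprime X Nc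
    coprime (inj₁ Nc≡1) (_ , d∣Nc) = ∣1⇒≡1 (subst (_ ∣_) Nc≡1 d∣Nc)
    coprime (inj₂ p∤X) (d∣X , d∣Nc) =
      coprime-divisor-of-power prime c _ (λ p∣d → p∤X (∣-trans p∣d d∣X)) d∣Nc

  -- If p ∣ N₂, the second coordinates of a generating pair are not both
  -- divisible by p: those elements form a proper subgroup.
  not-both-divisible : p ∣ N₂ → ∀ {x y} → Generates {p} {a} {b} x y → p ∣ π₂ x → p ∣ π₂ y → ⊥
  not-both-divisible p∣N₂ gen p∣x p∣y = <⇒≱ 1<p
    (∣⇒≤ (∣n∣m%n⇒∣m p∣N₂ (subst (p ∣_) (π₂-elt 0 1) (gen S subgroup p∣x p∣y (elt 0 1)))))
    where
    S : GG → Set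
    S g = p ∣ π₂ g
    subgroup : IsSubgroup {p} {a} {b} S
    subgroup = (O , subst (p ∣_) (sym (π₂-elt 0 0)) (%-presˡ-∣ (p ∣0) p∣N₂))
      , (λ g h p∣g p∣h → subst (p ∣_) (sym (toℕ-+ₘ (proj₂ g) (proj₂ h)))
                           (%-presˡ-∣ (∣m∣n⇒∣m+n p∣g p∣h) p∣N₂))
      , (λ g p∣g → subst (p ∣_) (sym (toℕ-negₘ (proj₂ g))) (%-presˡ-∣
           (∣m+n∣m⇒∣n (subst (p ∣_) (sym (m+[n∸m]≡n (<⇒≤ (toℕ<n (proj₂ g))))) p∣N₂) p∣g) p∣N₂))

  standard : Fin Nc → Des
  standard i = (elt 0 1 , elt 1 (toℕ i)) , standard-generates (toℕ i) (<Nc⇒≤N₂ (toℕ<n i))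

  standard-complete : (D : Des) → Nc ≡ 1 ⊎ ¬ p ∣ π₂ (proj₁ (proj₁ D)) → ∃ λ i → D ≅ standard i
  standard-complete ((x , y) , gen) unit =
    let (t , t<Nc , tx≈y) = solve-mod-Nc (π₂ x) (π₂ y) unit
        (h , aut , hx , hy) = to-standard x y t<Nc tx≈y gen
    in fromℕ< t<Nc , h , aut , hx , trans hy (cong (elt 1) (sym (toℕ-fromℕ< t<Nc)))

  standard-distinct : ∀ {i j} → i ≢ j → ¬ (standard i ≅ standard j)
  standard-distinct i≢j (f , aut , f01 , f1t) =
    i≢j (toℕ-injective (standard-rigid (toℕ<n _) (toℕ<n _) f aut f01 f1t))

  module PositiveLevel (c′ : ℕ) (c≡1+c′ : c ≡ suc c′) where

    M : ℕ
    M = p ^ (a + c′)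

    instance
      M≢0 : NonZero M
      M≢0 = m^n≢0 p (a + c′)

    N₂≡M*p : N₂ ≡ M * p
    N₂≡M*p = trans (cong (p ^_) (trans b≡a+c (trans (cong (λ z → a + z) c≡1+c′) (+-suc a c′))))
                   (*-comm p M)

    Nc≡p^c′*p : Nc ≡ p ^ c′ * p
    Nc≡p^c′*p = trans (cong (p ^_) c≡1+c′) (*-comm p (p ^ c′))

    p∣Nc : p ∣ Nc
    p∣Nc = subst (p ∣_) (sym Nc≡p^c′*p) (n∣m*n (p ^ c′))

    -- (0,1) has order N₂, whereas (1,s) with p ∣ s is killed by M = N₂/p;
    -- so no automorphism maps the one to the other.
    no-automorphism-to-divisible : ∀ {s} → p ∣ s → (f : GG → GG) → IsAutomorphism {p} {a} {b} f →
                                   f (elt 0 1) ≡ elt 1 s → ⊥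
    no-automorphism-to-divisible {s} p∣s f aut f01 = <⇒≱ M<N₂ (∣⇒≤ N₂∣M)
      where
      open Automorphism f aut
      N₁∣M : N₁ ∣ M
      N₁∣M = subst (N₁ ∣_) (sym (^-distribˡ-+-* p a c′)) (m∣m*n _)
      kills-1s : mul M (elt 1 s) ≡ O
      kills-1s = trans (mul-elt M 1 s) (elt-≡ (M₁.∣⇒≈0 (∣m⇒∣m*n 1 N₁∣M))
        (M₂.∣⇒≈0 (subst (_∣ M * s) (sym N₂≡M*p) (*-monoʳ-∣ M p∣s))))
      kills-01 : mul M (elt 0 1) ≡ O
      kills-01 = injective (trans (preserves-mul M _)
        (trans (cong (mul M) f01) (trans kills-1s (sym preserves-O))))
      N₂∣M : N₂ ∣ M
      N₂∣M = subst (N₂ ∣_) (*-identityʳ M)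
        (M₂.≈0⇒∣ (proj₂ (elt-≡⁻¹ (trans (sym (mul-elt M 0 1)) kills-01))))
      M<N₂ : M < N₂
      M<N₂ = subst (M <_) (sym N₂≡M*p) (m<m*n M p 1<p)

    kp<Nc : ∀ (k : Fin (p ^ c′)) → toℕ k * p < Nc
    kp<Nc k = subst (toℕ k * p <_) (sym Nc≡p^c′*p) (*-monoˡ-< p (toℕ<n k))

    special : Fin (p ^ c′) → Des
    special k = (elt 1 (toℕ k * p) , elt 0 1) ,
                generates-swap (standard-generates (toℕ k * p) (<Nc⇒≤N₂ (kp<Nc k)))

    -- Every pair whose first element has second coordinate divisible by p
    -- is equivalent to a special one: the second element then has second
    -- coordinate prime to p, and the multiplier s with s·y₂ ≡ x₂ is
    -- divisible by p.
    special-complete : (D : Des) → p ∣ π₂ (proj₁ (proj₁ D)) → ∃ λ k → D ≅ special k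
    special-complete ((x , y) , gen) p∣x = from-solution (solve-mod-Nc (π₂ y) (π₂ x) (inj₂ p∤y))
      where
      p∤y : ¬ p ∣ π₂ y
      p∤y = not-both-divisible (∣-trans p∣Nc Nc∣N₂) gen p∣x
      from-solution : (∃ λ s → s < Nc × s * π₂ y ≈c π₂ x) → ∃ λ k → ((x , y) , gen) ≅ special k
      from-solution (s , s<Nc , sy≈x) =
        let (h , aut , hy , hx) = to-standard y x s<Nc sy≈x (generates-swap gen)
        in fromℕ< k<p^c′ , h , aut ,
           trans hx (cong (elt 1) (trans s≡k*p (cong (_* p) (sym (toℕ-fromℕ< k<p^c′))))) , hy
        where
        p∣sy : p ∣ s * π₂ y
        p∣sy = ∣n∣m%n⇒∣m p∣Nc (subst (p ∣_) (sym sy≈x) (%-presˡ-∣ p∣x p∣Nc))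
        p∣s : p ∣ s
        p∣s = [ (λ p∣s → p∣s) , (λ p∣y → ⊥-elim (p∤y p∣y)) ]′ (euclidsLemma s (π₂ y) prime p∣sy)
        s≡k*p : s ≡ quotient p∣s * p
        s≡k*p = m∣n⇒n≡quotient*m p∣s
        k<p^c′ : quotient p∣s < p ^ c′
        k<p^c′ = *-cancelʳ-< p _ (p ^ c′) (subst₂ _<_ s≡k*p Nc≡p^c′*p s<Nc)

    special-distinct : ∀ {i j} → i ≢ j → ¬ (special i ≅ special j)
    special-distinct {i} {j} i≢j (f , aut , f1s , f01) = i≢j (toℕ-injective
      (*-cancelʳ-≡ (toℕ i) (toℕ j) p (standard-rigid (kp<Nc i) (kp<Nc j) f aut f01 f1s)))

    standard≇special : ∀ i k → ¬ (standard i ≅ special k)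
    standard≇special i k (f , aut , f01 , _) = no-automorphism-to-divisible (n∣m*n (toℕ k)) f aut f01

    classify : (D : Des) → (∃ λ i → D ≅ standard i) ⊎ (∃ λ k → D ≅ special k)
    classify D with p ∣? π₂ (proj₁ (proj₁ D))
    ... | yes p∣x = inj₂ (special-complete D p∣x)
    ... | no p∤x = inj₁ (standard-complete D (inj₂ p∤x))

-- ψ(p^c) written out: 1 if c = 0, and p^c + p^(c-1) otherwise.
classCount : ℕ → ℕ → ℕ
classCount p zero = 1
classCount p (suc c) = p ^ suc c + p ^ c

census : (p a b c : ℕ) → Prime p → b ≡ a + c →
  Σ (List (Dessin {p} {a} {b})) λ L →
    (∀ D → Any (λ E → _≅D_ {p} {a} {b} D E) L)
    × AllPairs (λ D E → ¬ (_≅D_ {p} {a} {b} D E)) L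
    × length L ≡ classCount p c
census p a b zero pr b≡a+0 =
    tabulate standard
  , (λ D → let (i , D≅i) = standard-complete D (inj₁ refl) in Any.tabulate⁺ {f = standard} i D≅i)
  , AllPairs.tabulate⁺ {f = standard} standard-distinct
  , length-tabulate standard
  where open Classification p a b 0 pr b≡a+0
census p a b (suc c′) pr b≡a+c =
    tabulate standard ++ tabulate special
  , complete
  , AllPairs.++⁺ (AllPairs.tabulate⁺ {f = standard} standard-distinct) (AllPairs.tabulate⁺ {f = special} special-distinct)
      (All.tabulate⁺ {f = standard} (λ i → All.tabulate⁺ {f = special} (standard≇special i)))
  , trans (length-++ (tabulate standard))
          (cong₂ _+_ (length-tabulate standard) (length-tabulate special))
  where
  open Classification p a b (suc c′) pr b≡a+c
  open PositiveLevel c′ refl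
  complete : ∀ D → Any (D ≅_) (tabulate standard ++ tabulate special)
  complete D with classify D
  ... | inj₁ (i , D≅i) = Any.++⁺ˡ (Any.tabulate⁺ {f = standard} i D≅i)
  ... | inj₂ (k , D≅k) = Any.++⁺ʳ (tabulate standard) (Any.tabulate⁺ {f = special} k D≅k)

product : (ℕ → ℚ.ℚ) → (ℕ → ℕ) → ℕ → ℚ.ℚ
product f h m = foldr ℚ._*_ ℚ.1ℚ (map f (applyUpTo h m))

product-ones : ∀ f m h → (∀ i → i < m → f (h i) ≡ ℚ.1ℚ) → product f h m ≡ ℚ.1ℚ
product-ones f zero h ones = refl
product-ones f (suc m) h ones =
  cong₂ ℚ._*_ (ones 0 z<s) (product-ones f m (h ∘ suc) (λ i i<m → ones (suc i) (s<s i<m)))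

product-single : ∀ f r m h j → j < m → f (h j) ≡ r →
                 (∀ i → i < m → i ≢ j → f (h i) ≡ ℚ.1ℚ) → product f h m ≡ r
product-single f r (suc m) h zero _ fj≡r others =
  trans (cong₂ ℚ._*_ fj≡r (product-ones f m (h ∘ suc) (λ i i<m → others (suc i) (s<s i<m) λ ())))
        (ℚ.*-identityʳ r)
product-single f r (suc m) h (suc j) (s<s j<m) fj≡r others =
  trans (cong₂ ℚ._*_ (others 0 z<s λ ())
          (product-single f r m (h ∘ suc) j j<m fj≡r
            (λ i i<m i≢j → others (suc i) (s<s i<m) (i≢j ∘ suc-injective))))
        (ℚ.*-identityˡ r)

times-1+1/q : ∀ q′ m → (+ (suc q′ * m) / 1) ℚ.* (+ suc (suc q′) / suc q′) ≡ + (suc q′ * m + m) / 1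
times-1+1/q q′ m = ℚ.toℚᵘ-injective (ℚᵘ.≃-trans (ℚ.toℚᵘ-homo-* (+ Y / 1) (+ Z / suc q′))
    (ℚᵘ.≃-trans (ℚᵘ.*-cong (ℚ.toℚᵘ-fromℚᵘ (ℚᵘ.mkℚᵘ (+ Y) 0)) (ℚ.toℚᵘ-fromℚᵘ (ℚᵘ.mkℚᵘ (+ Z) q′)))
    (ℚᵘ.≃-trans cross-multiplied (ℚᵘ.≃-sym (ℚ.toℚᵘ-fromℚᵘ (ℚᵘ.mkℚᵘ (+ X) 0))))))
  where
  X = suc q′ * m + m
  Y = suc q′ * m
  Z = suc (suc q′)
  expand : ∀ m q′ → (suc q′ * m * suc (suc q′)) * 1 ≡ (suc q′ * m + m) * suc (q′ + 0)
  expand = solve-∀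
  cross-multiplied : (ℚᵘ.mkℚᵘ (+ Y) 0 ℚᵘ.* ℚᵘ.mkℚᵘ (+ Z) q′) ℚᵘ.≃ ℚᵘ.mkℚᵘ (+ X) 0
  cross-multiplied = ℚᵘ.*≡* (trans (cong (λ z → z ℤ.* + 1) (sym (ℤ.pos-* Y Z)))
    (trans (sym (ℤ.pos-* (Y * Z) 1)) (trans (cong +_ (expand m q′)) (ℤ.pos-* X (suc (q′ + 0))))))

-- ψ(p^c) = classCount p c: the only prime factor of p^c is p itself.
ψ-prime-power : ∀ {p} → Prime p → ∀ c → ψ (p ^ c) ≡ + classCount p c / 1
ψ-prime-power {zero} pr c = ⊥-elim (<⇒≱ (nonTrivial⇒n>1 0 {{prime⇒nonTrivial pr}}) z≤n)
ψ-prime-power {suc q′} pr zero = refl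
ψ-prime-power {suc q′} pr (suc c) =
  trans (cong ((+ n / 1) ℚ.*_) factors) (times-1+1/q q′ (suc q′ ^ c))
  where
  n = suc q′ ^ suc c
  factor-p : ψfactor n q′ ≡ + suc (suc q′) / suc q′
  factor-p with prime? (suc q′) ×-dec (suc q′ ∣? n)
  ... | yes _ = refl
  ... | no ¬p∣n = ⊥-elim (¬p∣n (pr , m∣m*n (suc q′ ^ c)))
  factor-other : ∀ k → k ≢ q′ → ψfactor n k ≡ ℚ.1ℚ
  factor-other k k≢q′ with prime? (suc k) ×-dec (suc k ∣? n)
  ... | yes (prime-k , k∣n) = ⊥-elim (k≢q′ (suc-injective (prime-divisor-of-power pr prime-k (suc c) k∣n)))
  ... | no _ = refl
  q′<n : q′ < n
  q′<n = <-≤-trans (n<1+n q′) (m≤m*n (suc q′) (suc q′ ^ c) {{m^n≢0 (suc q′) c}})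
  factors : product (ψfactor n) (λ i → i) n ≡ + suc (suc q′) / suc q′
  factors = product-single (ψfactor n) _ n (λ i → i) q′ q′<n factor-p (λ i _ i≢q′ → factor-other i i≢q′)

corollary4p10 : (p a b : ℕ) → Prime p → a ≤ b →
    Σ (List (Dessin {p} {a} {b})) λ L →
      (∀ D → Any (λ E → _≅D_ {p} {a} {b} D E) L)
      × AllPairs (λ D E → ¬ (_≅D_ {p} {a} {b} D E)) L
      × (+ length L / 1) ≡ ψ (p ^ (b ∸ a))
corollary4p10 p a b pr a≤b =
  let (L , complete , irredundant , length≡count) = census p a b (b ∸ a) pr (sym (m+[n∸m]≡n a≤b))
  in L , complete , irredundant ,
     trans (cong (λ k → + k / 1) length≡count) (sym (ψ-prime-power pr (b ∸ a)))
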